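{- Let $\lambda$ be a nonzero real number. For every integer $n\ge0$, \[ J_{n,\lambda}(x)=\sum_{m=0}^{n}B_{m,\lambda}(x)\,S_{2,\lambda}(n,m), \] and in particular $J_{n,\lambda}=\sum_{m=0}^{n}B_{m,\lambda}S_{2,\lambda}(n,m)$.
   Context: For a nonzero real $\lambda$, set $(x)_{0,\lambda}=1$ and $(x)_{n,\lambda}=x(x-\lambda)\cdots(x-(n-1)\lambda)$ for $n\ge1$. Let $e_\lambda^x(t)=\sum_{n\ge0}(x)_{n,\lambda}\frac{t^n}{n!}=(1+\lambda t)^{x/\lambda}$ and $e_\lambda(t)=e_\lambda^1(t)$. The degenerate Stirling numbers of the second kind are defined by $\frac{1}{k!}(e_\lambda(t)-1)^k=\sum_{n\ge k}S_{2,\lambda}(n,k)\frac{t^n}{n!}$. The degenerate Bell polynomials are defined by $e_\lambda^x(e_\lambda(t)-1)=\sum_{n\ge0}B_{n,\lambda}(x)\frac{t^n}{n!}$, with $B_{n,\lambda}=B_{n,\lambda}(1)$. The Jindalrae polynomials are defined by $e_\lambda^x\big(e_\lambda(e_\lambda(t)-1)-1\big)=\sum_{n\ge0}J_{n,\lambda}(x)\frac{t^n}{n!}$, with $J_{n,\lambda}=J_{n,\lambda}(1)$. -}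

module Defs where

open import Level using (Level; _⊔_) renaming (suc to lsuc)
open import Algebra.Bundles using (CommutativeRing)
open import Data.Nat using (ℕ; zero; suc; _∸_; _!)

natCast : ∀ {c ℓ} (R : CommutativeRing c ℓ) → ℕ → CommutativeRing.Carrier R
natCast R zero = CommutativeRing.0# R
natCast R (suc n) = CommutativeRing._+_ R (CommutativeRing.1# R) (natCast R n)

-- This is where the generating-function definitions
-- (which divide by n!) make sense.  The reals are an instance.
record QAlgebra (c ℓ : Level) : Set (lsuc (c ⊔ ℓ)) where
  field
    cring : CommutativeRing c ℓ
  open CommutativeRing cring
  field
    inv      : ℕ → Carrier            -- inv n = 1/(n+1)
    inv-spec : ∀ n → natCast cring (suc n) * inv n ≈ 1#

module Degenerate {c ℓ : Level} (A : QAlgebra c ℓ) where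
  open QAlgebra A public
  open CommutativeRing cring public hiding (zero)

  ι : ℕ → Carrier
  ι = natCast cring

  -- formal power series in t, given by ordinary coefficients (coefficient of t^n)
  PS : Set c
  PS = ℕ → Carrier

  sumTo : (ℕ → Carrier) → ℕ → Carrier
  sumTo f zero = f zero
  sumTo f (suc n) = sumTo f n + f (suc n)

  one : PS
  one zero = 1#
  one (suc n) = 0#

  mulPS : PS → PS → PS
  mulPS f g n = sumTo (λ i → f i * g (n ∸ i)) n

  powPS : PS → ℕ → PS
  powPS g zero = one
  powPS g (suc k) = mulPS g (powPS g k)

  -- composition f(g(t)); the coefficient of t^n is Σ_{k≤n} f_k [t^n] g^k,
  -- which is the composition whenever g has zero constant term
  -- (the only way it is used below).
  compPS : PS → PS → PS
  compPS f g n = sumTo (λ k → f k * powPS g k n) n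

  invFact : ℕ → Carrier
  invFact zero = 1#
  invFact (suc n) = invFact n * inv n

  fall : Carrier → Carrier → ℕ → Carrier
  fall x l zero = 1#
  fall x l (suc n) = fall x l n * (x - ι n * l)

  -- e_λ^x(t) = Σ (x)_{n,λ} t^n / n!
  eλx : Carrier → Carrier → PS
  eλx l x n = fall x l n * invFact n

  eλ : Carrier → PS
  eλ l = eλx l 1#

  eλ-1 : Carrier → PS
  eλ-1 l n = eλ l n - one n

  eλeλ-1 : Carrier → PS
  eλeλ-1 l n = compPS (eλ l) (eλ-1 l) n - one n

  -- degenerate Stirling numbers of the second kind:
  -- (1/k!) (e_λ(t)-1)^k = Σ_n S_{2,λ}(n,k) t^n/n!
  S2 : Carrier → ℕ → ℕ → Carrier
  S2 l n k = ι (n !) * (invFact k * powPS (eλ-1 l) k n)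

  -- degenerate Bell polynomials: e_λ^x(e_λ(t)-1) = Σ B_{n,λ}(x) t^n/n!
  Bell : Carrier → Carrier → ℕ → Carrier
  Bell l x n = ι (n !) * compPS (eλx l x) (eλ-1 l) n

  -- Jindalrae polynomials: e_λ^x(e_λ(e_λ(t)-1)-1) = Σ J_{n,λ}(x) t^n/n!
  Jin : Carrier → Carrier → ℕ → Carrier
  Jin l x n = ι (n !) * compPS (eλx l x) (eλeλ-1 l) n

{-# OPTIONS --safe #-}
module Submission where

-- The identity is the coefficient form of e_λ^x(e_λ(e_λ(t)-1)-1) = (e_λ^x ∘ u) ∘ u with
-- u = e_λ(t) - 1: composing with u from outside (compPS F (compPS u u)) agrees with composing
-- twice (compPS (compPS F u) u), and the coefficient of t^n in Σ_m [e_λ^x ∘ u]_m u^m is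
-- Σ_m (B_{m,λ}(x)/m!)(m! S_{2,λ}(n,m)/n!).  Associativity of composition holds for inner
-- series with zero constant term, because f ↦ f ∘ u is then multiplicative, so powers of
-- v ∘ u are compositions of powers of v.

open import Defs
open import Level using (Level)
open import Data.Nat using (ℕ; zero; suc; _∸_; _≤_; _<_; z≤n; s≤s; _!)
import Data.Nat as ℕ
import Data.Nat.Properties as ℕ
open import Data.Product using (_×_; _,_)
open import Data.Sum using (inj₁; inj₂)
open import Relation.Nullary using (¬_)
open import Relation.Binary.PropositionalEquality as ≡ using (_≡_)
import Algebra.Properties.Ring as RingProperties
import Algebra.Properties.AbelianGroup as AbelianGroupProperties
import Algebra.Properties.CommutativeSemigroup as CommutativeSemigroupProperties
import Algebra.Properties.Semiring.Mult as SemiringMult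

module _ {c ℓ : Level} (A : QAlgebra c ℓ) where
  open Degenerate A
  open import Relation.Binary.Reasoning.Setoid setoid
  open RingProperties ring using (-‿distribˡ-*)
  open AbelianGroupProperties +-abelianGroup using (⁻¹-∙-comm)
  open CommutativeSemigroupProperties +-commutativeSemigroup using () renaming (interchange to +-interchange)
  open CommutativeSemigroupProperties *-commutativeSemigroup using () renaming (interchange to *-interchange; x∙yz≈y∙xz to *-lcomm)
  open SemiringMult semiring using (×1-homo-*) renaming (_×_ to _·_)

  sumTo-cong : ∀ {f g : PS} n → (∀ i → i ≤ n → f i ≈ g i) → sumTo f n ≈ sumTo g n
  sumTo-cong zero f≈g = f≈g zero z≤n
  sumTo-cong (suc n) f≈g =
    +-cong (sumTo-cong n (λ i i≤n → f≈g i (ℕ.m≤n⇒m≤1+n i≤n))) (f≈g (suc n) ℕ.≤-refl)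

  sumTo-zero : ∀ (f : PS) n → (∀ i → i ≤ n → f i ≈ 0#) → sumTo f n ≈ 0#
  sumTo-zero f n f≈0 = trans (sumTo-cong n f≈0) (sumTo-0# n)
    where
    sumTo-0# : ∀ n → sumTo (λ _ → 0#) n ≈ 0#
    sumTo-0# zero = refl
    sumTo-0# (suc n) = trans (+-congʳ (sumTo-0# n)) (+-identityˡ 0#)

  sumTo-distrib-+ : ∀ (f g : PS) n → sumTo (λ i → f i + g i) n ≈ sumTo f n + sumTo g n
  sumTo-distrib-+ f g zero = refl
  sumTo-distrib-+ f g (suc n) = trans (+-congʳ (sumTo-distrib-+ f g n)) (+-interchange _ _ _ _)

  sumTo-distrib-neg : ∀ (f : PS) n → sumTo (λ i → - f i) n ≈ - sumTo f n
  sumTo-distrib-neg f zero = refl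
  sumTo-distrib-neg f (suc n) = trans (+-congʳ (sumTo-distrib-neg f n)) (⁻¹-∙-comm _ _)

  sumTo-distrib-- : ∀ (f g : PS) n → sumTo (λ i → f i - g i) n ≈ sumTo f n - sumTo g n
  sumTo-distrib-- f g n = trans (sumTo-distrib-+ f (λ i → - g i) n) (+-congˡ (sumTo-distrib-neg g n))

  *-distribˡ-sumTo : ∀ x (f : PS) n → x * sumTo f n ≈ sumTo (λ i → x * f i) n
  *-distribˡ-sumTo x f zero = refl
  *-distribˡ-sumTo x f (suc n) = trans (distribˡ x _ _) (+-congʳ (*-distribˡ-sumTo x f n))

  *-distribʳ-sumTo : ∀ x (f : PS) n → sumTo f n * x ≈ sumTo (λ i → f i * x) n
  *-distribʳ-sumTo x f zero = refl
  *-distribʳ-sumTo x f (suc n) = trans (distribʳ x _ _) (+-congʳ (*-distribʳ-sumTo x f n))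

  sumTo-one-* : ∀ (f : PS) n → sumTo (λ i → one i * f i) n ≈ f 0
  sumTo-one-* f zero = *-identityˡ _
  sumTo-one-* f (suc n) = trans (+-cong (sumTo-one-* f n) (zeroˡ _)) (+-identityʳ _)

  sumTo-extend : ∀ (f : PS) {m n} → m ≤ n → (∀ i → m < i → i ≤ n → f i ≈ 0#) →
                 sumTo f n ≈ sumTo f m
  sumTo-extend f {n = zero} z≤n _ = refl
  sumTo-extend f {m} {suc n} m≤1+n f≈0 with ℕ.m≤n⇒m<n∨m≡n m≤1+n
  ... | inj₂ ≡.refl = refl
  ... | inj₁ (s≤s m≤n) =
    trans (+-cong (sumTo-extend f m≤n (λ i m<i i≤n → f≈0 i m<i (ℕ.m≤n⇒m≤1+n i≤n)))
                  (f≈0 (suc n) (s≤s m≤n) ℕ.≤-refl))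
          (+-identityʳ _)

  sumTo-comm : ∀ (F : ℕ → ℕ → Carrier) m n →
    sumTo (λ i → sumTo (F i) n) m ≈ sumTo (λ j → sumTo (λ i → F i j) m) n
  sumTo-comm F zero n = refl
  sumTo-comm F (suc m) n =
    trans (+-congʳ (sumTo-comm F m n)) (sym (sumTo-distrib-+ (λ j → sumTo (λ i → F i j) m) (F (suc m)) n))

  sumTo-triangle : ∀ (F : ℕ → ℕ → Carrier) n →
    sumTo (λ k → sumTo (λ p → F p (k ∸ p)) k) n ≈ sumTo (λ p → sumTo (F p) (n ∸ p)) n
  sumTo-triangle F zero = refl
  sumTo-triangle F (suc n) = begin
      sumTo (λ k → sumTo (λ p → F p (k ∸ p)) k) n + (sumTo (λ p → F p (suc n ∸ p)) n + F (suc n) (n ∸ n))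
    ≈⟨ +-cong (sumTo-triangle F n) (+-congˡ (reflexive (≡.cong (F (suc n)) (ℕ.n∸n≡0 n)))) ⟩
      sumTo (λ p → sumTo (F p) (n ∸ p)) n + (sumTo (λ p → F p (suc n ∸ p)) n + F (suc n) 0)
    ≈⟨ sym (+-assoc _ _ _) ⟩
      (sumTo (λ p → sumTo (F p) (n ∸ p)) n + sumTo (λ p → F p (suc n ∸ p)) n) + F (suc n) 0
    ≈⟨ +-congʳ (sym (sumTo-distrib-+ _ _ n)) ⟩
      sumTo (λ p → sumTo (F p) (n ∸ p) + F p (suc n ∸ p)) n + F (suc n) 0
    ≈⟨ +-cong (sumTo-cong n row) (reflexive (≡.cong (sumTo (F (suc n))) (≡.sym (ℕ.n∸n≡0 n)))) ⟩
      sumTo (λ p → sumTo (F p) (suc n ∸ p)) n + sumTo (F (suc n)) (n ∸ n) ∎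
    where
    row : ∀ p → p ≤ n → sumTo (F p) (n ∸ p) + F p (suc n ∸ p) ≈ sumTo (F p) (suc n ∸ p)
    row p p≤n rewrite ℕ.+-∸-assoc 1 p≤n = refl

  mulPS-cong : ∀ {f f′ g g′ : PS} → (∀ n → f n ≈ f′ n) → (∀ n → g n ≈ g′ n) →
               ∀ n → mulPS f g n ≈ mulPS f′ g′ n
  mulPS-cong f≈f′ g≈g′ n = sumTo-cong n (λ i _ → *-cong (f≈f′ i) (g≈g′ (n ∸ i)))

  powPS-cong : ∀ {g g′ : PS} → (∀ n → g n ≈ g′ n) → ∀ k n → powPS g k n ≈ powPS g′ k n
  powPS-cong g≈g′ zero n = refl
  powPS-cong g≈g′ (suc k) n = mulPS-cong g≈g′ (powPS-cong g≈g′ k) n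

  compPS-congʳ : ∀ (f : PS) {u u′ : PS} → (∀ n → u n ≈ u′ n) → ∀ n → compPS f u n ≈ compPS f u′ n
  compPS-congʳ f u≈u′ n = sumTo-cong n (λ k _ → *-congˡ (powPS-cong u≈u′ k n))

  mulPS-assoc : ∀ (f g h : PS) n → mulPS (mulPS f g) h n ≈ mulPS f (mulPS g h) n
  mulPS-assoc f g h n = begin
      sumTo (λ k → sumTo (λ p → f p * g (k ∸ p)) k * h (n ∸ k)) n
    ≈⟨ sumTo-cong n (λ k _ → trans (*-distribʳ-sumTo _ _ k) (sumTo-cong k (λ p p≤k → reassoc k p p≤k))) ⟩
      sumTo (λ k → sumTo (λ p → F p (k ∸ p)) k) n
    ≈⟨ sumTo-triangle F n ⟩
      sumTo (λ p → sumTo (F p) (n ∸ p)) n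
    ≈⟨ sumTo-cong n (λ p _ → sym (*-distribˡ-sumTo (f p) _ (n ∸ p))) ⟩
      sumTo (λ p → f p * sumTo (λ q → g q * h (n ∸ p ∸ q)) (n ∸ p)) n ∎
    where
    F : ℕ → ℕ → Carrier
    F p q = f p * (g q * h (n ∸ p ∸ q))
    reassoc : ∀ k p → p ≤ k → (f p * g (k ∸ p)) * h (n ∸ k) ≈ F p (k ∸ p)
    reassoc k p p≤k = trans (*-assoc _ _ _) (*-congˡ (*-congˡ (reflexive (≡.cong h n∸k≡n∸p∸[k∸p]))))
      where
      n∸k≡n∸p∸[k∸p] : n ∸ k ≡ n ∸ p ∸ (k ∸ p)
      n∸k≡n∸p∸[k∸p] = ≡.sym (≡.trans (ℕ.∸-+-assoc n p (k ∸ p)) (≡.cong (n ∸_) (ℕ.m+[n∸m]≡n p≤k)))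

  powPS-+ : ∀ (u : PS) p q n → powPS u (p ℕ.+ q) n ≈ mulPS (powPS u p) (powPS u q) n
  powPS-+ u zero q n = sym (sumTo-one-* (λ i → powPS u q (n ∸ i)) n)
  powPS-+ u (suc p) q n =
    trans (mulPS-cong (λ _ → refl) (powPS-+ u p q) n) (sym (mulPS-assoc u (powPS u p) (powPS u q) n))

  compPS-sub-one : ∀ (f u : PS) n → compPS (λ k → f k - one k) u n ≈ compPS f u n - one n
  compPS-sub-one f u n = begin
      sumTo (λ k → (f k - one k) * powPS u k n) n
    ≈⟨ sumTo-cong n (λ k _ → trans (distribʳ _ _ _) (+-congˡ (sym (-‿distribˡ-* _ _)))) ⟩
      sumTo (λ k → f k * powPS u k n - one k * powPS u k n) n
    ≈⟨ sumTo-distrib-- _ _ n ⟩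
      compPS f u n - sumTo (λ k → one k * powPS u k n) n
    ≈⟨ +-congˡ (-‿cong (sumTo-one-* (λ k → powPS u k n) n)) ⟩
      compPS f u n - one n ∎

  module ZeroConstantTerm (u : PS) (u₀≈0 : u 0 ≈ 0#) where

    powPS-vanish : ∀ k n → n < k → powPS u k n ≈ 0#
    powPS-vanish (suc k) n (s≤s n≤k) = sumTo-zero _ n term
      where
      term : ∀ i → i ≤ n → u i * powPS u k (n ∸ i) ≈ 0#
      term zero _ = trans (*-congʳ u₀≈0) (zeroˡ _)
      term (suc j) 1+j≤n =
        trans (*-congˡ (powPS-vanish k (n ∸ suc j) (ℕ.<-≤-trans (ℕ.∸-monoʳ-< (s≤s z≤n) 1+j≤n) n≤k)))
              (zeroʳ _)

    compPS-extend : ∀ (f : PS) {n N} → n ≤ N → compPS f u n ≈ sumTo (λ k → f k * powPS u k n) N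
    compPS-extend f {n} n≤N =
      sym (sumTo-extend _ n≤N (λ k n<k _ → trans (*-congˡ (powPS-vanish k n n<k)) (zeroʳ _)))

    compPS-mulPS : ∀ (f g : PS) n → mulPS (compPS f u) (compPS g u) n ≈ compPS (mulPS f g) u n
    compPS-mulPS f g n = begin
        sumTo (λ i → compPS f u i * compPS g u (n ∸ i)) n
      ≈⟨ sumTo-cong n (λ i i≤n → *-cong (compPS-extend f i≤n) (compPS-extend g (ℕ.m∸n≤m n i))) ⟩
        sumTo (λ i → sumTo (λ p → f p * powPS u p i) n * sumTo (λ q → g q * powPS u q (n ∸ i)) n) n
      ≈⟨ sumTo-cong n (λ i _ → trans (*-distribʳ-sumTo _ _ n) (sumTo-cong n (λ p _ → *-distribˡ-sumTo _ _ n))) ⟩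
        sumTo (λ i → sumTo (λ p → sumTo (T i p) n) n) n
      ≈⟨ sumTo-comm (λ i p → sumTo (T i p) n) n n ⟩
        sumTo (λ p → sumTo (λ i → sumTo (T i p) n) n) n
      ≈⟨ sumTo-cong n (λ p _ → sumTo-comm (λ i → T i p) n n) ⟩
        sumTo (λ p → sumTo (λ q → sumTo (λ i → T i p q) n) n) n
      ≈⟨ sumTo-cong n (λ p _ → sumTo-cong n (λ q _ → collect p q)) ⟩
        sumTo (λ p → sumTo (G p) n) n
      ≈⟨ sumTo-cong n (λ p p≤n → sumTo-extend (G p) (ℕ.m∸n≤m n p) (λ q n∸p<q _ → G-vanish p q p≤n n∸p<q)) ⟩
        sumTo (λ p → sumTo (G p) (n ∸ p)) n
      ≈⟨ sym (sumTo-triangle G n) ⟩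
        sumTo (λ k → sumTo (λ p → G p (k ∸ p)) k) n
      ≈⟨ sumTo-cong n (λ k _ → trans (sumTo-cong k (λ p p≤k → *-congˡ
             (reflexive (≡.cong (λ m → powPS u m n) (ℕ.m+[n∸m]≡n p≤k))))) (sym (*-distribʳ-sumTo _ _ k))) ⟩
        sumTo (λ k → mulPS f g k * powPS u k n) n ∎
      where
      T : ℕ → ℕ → ℕ → Carrier
      T i p q = (f p * powPS u p i) * (g q * powPS u q (n ∸ i))
      G : ℕ → ℕ → Carrier
      G p q = (f p * g q) * powPS u (p ℕ.+ q) n
      collect : ∀ p q → sumTo (λ i → T i p q) n ≈ G p q
      collect p q = trans (sumTo-cong n (λ i _ → *-interchange _ _ _ _))
                          (trans (sym (*-distribˡ-sumTo _ _ n)) (*-congˡ (sym (powPS-+ u p q n))))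
      G-vanish : ∀ p q → p ≤ n → n ∸ p < q → G p q ≈ 0#
      G-vanish p q p≤n n∸p<q = trans (*-congˡ (powPS-vanish (p ℕ.+ q) n
        (≡.subst (_< p ℕ.+ q) (ℕ.m+[n∸m]≡n p≤n) (ℕ.+-monoʳ-< p n∸p<q)))) (zeroʳ _)

    compPS-powPS : ∀ (v : PS) k n → powPS (compPS v u) k n ≈ compPS (powPS v k) u n
    compPS-powPS v zero n = sym (sumTo-one-* (λ k → powPS u k n) n)
    compPS-powPS v (suc k) n =
      trans (mulPS-cong (λ _ → refl) (compPS-powPS v k) n) (compPS-mulPS v (powPS v k) n)

  compPS-assoc : ∀ (f : PS) {v u : PS} → v 0 ≈ 0# → u 0 ≈ 0# →
                 ∀ n → compPS f (compPS v u) n ≈ compPS (compPS f v) u n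
  compPS-assoc f {v} {u} v₀≈0 u₀≈0 n = begin
      sumTo (λ k → f k * powPS (compPS v u) k n) n
    ≈⟨ sumTo-cong n (λ k _ → *-congˡ (compPS-powPS v k n)) ⟩
      sumTo (λ k → f k * sumTo (λ j → powPS v k j * powPS u j n) n) n
    ≈⟨ sumTo-cong n (λ k _ → *-distribˡ-sumTo _ _ n) ⟩
      sumTo (λ k → sumTo (λ j → f k * (powPS v k j * powPS u j n)) n) n
    ≈⟨ sumTo-comm _ n n ⟩
      sumTo (λ j → sumTo (λ k → f k * (powPS v k j * powPS u j n)) n) n
    ≈⟨ sumTo-cong n (λ j _ → trans (sumTo-cong n (λ k _ → sym (*-assoc _ _ _))) (sym (*-distribʳ-sumTo _ _ n))) ⟩
      sumTo (λ j → sumTo (λ k → f k * powPS v k j) n * powPS u j n) n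
    ≈⟨ sumTo-cong n (λ j j≤n → *-congʳ (sym (ZeroConstantTerm.compPS-extend v v₀≈0 f j≤n))) ⟩
      sumTo (λ j → compPS f v j * powPS u j n) n ∎
    where open ZeroConstantTerm u u₀≈0

  ι≈·1# : ∀ n → ι n ≈ n · 1#
  ι≈·1# zero = refl
  ι≈·1# (suc n) = +-congˡ (ι≈·1# n)

  ι-homo-* : ∀ m n → ι (m ℕ.* n) ≈ ι m * ι n
  ι-homo-* m n = trans (ι≈·1# (m ℕ.* n))
                       (trans (×1-homo-* m n) (sym (*-cong (ι≈·1# m) (ι≈·1# n))))

  ι[n!]*invFact : ∀ n → ι (n !) * invFact n ≈ 1#
  ι[n!]*invFact zero = trans (*-identityʳ _) (+-identityʳ _)
  ι[n!]*invFact (suc n) = begin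
      ι (suc n ℕ.* n !) * (invFact n * inv n)
    ≈⟨ *-cong (ι-homo-* (suc n) (n !)) (*-comm _ _) ⟩
      (ι (suc n) * ι (n !)) * (inv n * invFact n)
    ≈⟨ *-interchange _ _ _ _ ⟩
      (ι (suc n) * inv n) * (ι (n !) * invFact n)
    ≈⟨ *-cong (inv-spec n) (ι[n!]*invFact n) ⟩
      1# * 1#
    ≈⟨ *-identityˡ _ ⟩
      1# ∎

  eλ-1-constant : ∀ l → eλ-1 l 0 ≈ 0#
  eλ-1-constant l = trans (+-congʳ (*-identityˡ 1#)) (-‿inverseʳ 1#)

  eλeλ-1≈compPS : ∀ l n → eλeλ-1 l n ≈ compPS (eλ-1 l) (eλ-1 l) n
  eλeλ-1≈compPS l n = sym (compPS-sub-one (eλ l) (eλ-1 l) n)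

  Bell*S2 : ∀ l x n m → Bell l x m * S2 l n m ≈
            ι (n !) * (compPS (eλx l x) (eλ-1 l) m * powPS (eλ-1 l) m n)
  Bell*S2 l x n m = begin
      (ι (m !) * B) * (ι (n !) * (invFact m * P))
    ≈⟨ *-lcomm _ _ _ ⟩
      ι (n !) * ((ι (m !) * B) * (invFact m * P))
    ≈⟨ *-congˡ (*-interchange _ _ _ _) ⟩
      ι (n !) * ((ι (m !) * invFact m) * (B * P))
    ≈⟨ *-congˡ (trans (*-congʳ (ι[n!]*invFact m)) (*-identityˡ _)) ⟩
      ι (n !) * (B * P) ∎
    where
    B P : Carrier
    B = compPS (eλx l x) (eλ-1 l) m
    P = powPS (eλ-1 l) m n

  Jin≈sum-Bell*S2 : ∀ l x n → Jin l x n ≈ sumTo (λ m → Bell l x m * S2 l n m) n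
  Jin≈sum-Bell*S2 l x n = begin
      ι (n !) * compPS (eλx l x) (eλeλ-1 l) n
    ≈⟨ *-congˡ (compPS-congʳ (eλx l x) (eλeλ-1≈compPS l) n) ⟩
      ι (n !) * compPS (eλx l x) (compPS (eλ-1 l) (eλ-1 l)) n
    ≈⟨ *-congˡ (compPS-assoc (eλx l x) (eλ-1-constant l) (eλ-1-constant l) n) ⟩
      ι (n !) * sumTo (λ m → compPS (eλx l x) (eλ-1 l) m * powPS (eλ-1 l) m n) n
    ≈⟨ *-distribˡ-sumTo _ _ n ⟩
      sumTo (λ m → ι (n !) * (compPS (eλx l x) (eλ-1 l) m * powPS (eλ-1 l) m n)) n
    ≈⟨ sumTo-cong n (λ m _ → sym (Bell*S2 l x n m)) ⟩
      sumTo (λ m → Bell l x m * S2 l n m) n ∎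

theorem10 : ∀ {c ℓ : Level} (A : QAlgebra c ℓ) → let open Degenerate A in
    ∀ (l : Carrier) → ¬ (l ≈ 0#) →
    (∀ (x : Carrier) (n : ℕ) → Jin l x n ≈ sumTo (λ m → Bell l x m * S2 l n m) n)
    × (∀ (n : ℕ) → Jin l 1# n ≈ sumTo (λ m → Bell l 1# m * S2 l n m) n)
theorem10 A l _ = Jin≈sum-Bell*S2 A l , Jin≈sum-Bell*S2 A l (Degenerate.1# A)
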